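{- For every three integers $r,s,t$ with $2\le r\le s\le t$, there exists a graph $G$ such that $\delta(G)+1 = r$, $\gamma'_{\rm SMB}(G) = s$, and $\gamma_{\rm SMB}(G) = t$.
   Context: All graphs are finite and simple; $\delta(G)$ is the minimum degree of $G$ and $N_G[v]=N_G(v)\cup\{v\}$ is the closed neighborhood of $v$. The Maker-Breaker domination game on a graph $G$ is played by two players, Dominator and Staller, who alternately choose (play) a vertex of $G$ that has not been played before. Dominator wins if the set of vertices he has played is a dominating set of $G$; Staller wins if she has played all vertices of $N_G[v]$ for some vertex $v\in V(G)$ (exactly one of these eventually happens). In the D-game Dominator makes the first move, in the S-game Staller does. $\gamma_{\rm SMB}(G)$ (resp. $\gamma'_{\rm SMB}(G)$) is the smallest integer $k$ such that in the D-game (resp. S-game), under any strategy of Dominator, Staller can win having played at most $k$ vertices; if Staller has no winning strategy, the value is $\infty$. -}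

module Defs where

open import Data.Nat using (ℕ; zero; suc; _+_; _≤_; _<_)
open import Data.Bool using (Bool; true; false)
open import Data.Fin using (Fin)
open import Data.Fin.Subset using (Subset; _∈_; _∉_; _⊆_; _∪_; ⁅_⁆; ∣_∣)
  renaming (⊥ to ∅)
open import Data.Vec using (tabulate)
open import Data.Product using (Σ; ∃; _×_)
open import Relation.Binary.PropositionalEquality using (_≡_)
open import Relation.Nullary using (¬_)

record Graph : Set where
  field
    n     : ℕ
    adj   : Fin n → Fin n → Bool
    sym   : ∀ u v → adj u v ≡ adj v u
    irref : ∀ v → adj v v ≡ false

module _ (G : Graph) where
  open Graph G

  N : Fin n → Subset n
  N v = tabulate (adj v)

  N[_] : Fin n → Subset n
  N[ v ] = N v ∪ ⁅ v ⁆

  deg : Fin n → ℕ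
  deg v = ∣ N v ∣

  MinDegree : ℕ → Set
  MinDegree d = (∀ v → d ≤ deg v) × (∃ λ v → deg v ≡ d)

  Dominates : Subset n → Set
  Dominates D = ∀ v → ∃ λ u → u ∈ D × u ∈ N[ v ]

  StallerClaimed : Subset n → Set
  StallerClaimed S = ∃ λ v → N[ v ] ⊆ S

  -- Position: D = Dominator's vertices, S = Staller's vertices.
  -- SWinS k D S : Staller to move, she can force a win playing at most k
  --               further vertices (against every Dominator strategy).
  -- SWinD k D S : same, Dominator to move.
  data SWinS : ℕ → Subset n → Subset n → Set
  data SWinD : ℕ → Subset n → Subset n → Set

  data SWinS where
    wonS : ∀ {k D S} → StallerClaimed S → SWinS k D S
    play : ∀ {k D S} v → ¬ Dominates D → ¬ StallerClaimed S →
           v ∉ D → v ∉ S → SWinD k D (S ∪ ⁅ v ⁆) → SWinS (suc k) D S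

  data SWinD where
    wonD : ∀ {k D S} → StallerClaimed S → SWinD k D S
    reply : ∀ {k D S} → ¬ Dominates D → ¬ StallerClaimed S →
            (∀ v → v ∉ D → v ∉ S → SWinS k (D ∪ ⁅ v ⁆) S) → SWinD k D S

  γSMB≡ : ℕ → Set
  γSMB≡ k = SWinD k ∅ ∅ × (∀ j → j < k → ¬ SWinD j ∅ ∅)

  γ'SMB≡ : ℕ → Set
  γ'SMB≡ k = SWinS k ∅ ∅ × (∀ j → j < k → ¬ SWinS j ∅ ∅)

-- Let H_0 = K_1, let H_(d+1) be the cone (an apex) over two disjoint copies
-- of H_d, and take G = K_r ⊔ H_(s-1) ⊔ H_(t-1) ⊔ H_(t-1).  Every vertex of
-- H_d has degree at least d and the clique vertices have degree r - 1, so
-- δ(G) = r - 1.  Staller wins on a copy of H_d within d + 1 moves: she takes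
-- the apex, Dominator's answer misses one of the two copies of H_(d-1), and she
-- continues there.  This wins the S-game in s moves on H_(s-1), and the D-game
-- in t moves on a copy of H_(t-1) missed by Dominator's first move.
-- Conversely, let Dominator answer each of two clique vertices a, b by the
-- other and, in the D-game, open with the apex of H_(s-1).  Then Staller can
-- only complete a closed neighbourhood containing neither both a and b nor that
-- apex; these all have at least s, respectively t, vertices.

module Submission where

open import Defs
open import Data.Bool using (Bool; true; false; not)
open import Data.Fin using (Fin; zero; suc; _≟_; punchIn; punchOut)
open import Data.Fin.Properties
  using (any?; 1↔⊤; 2↔Bool; +↔⊎; *↔×; punchIn-injective; punchInᵢ≢i; punchIn-punchOut)
open import Data.Fin.Subset using (Subset; _∈_; _∉_; _⊆_; _∪_; _─_; _-_; ⁅_⁆; ∣_∣; inside; outside)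
  renaming (⊥ to ∅)
open import Data.Fin.Subset.Properties
  using ( _∈?_; _⊆?_; ∉⊥; ∣⊥∣≡0; ∪-identityʳ; p⊆p∪q; q⊆p∪q; x∈p∪q⁻; x∈⁅x⁆; x∈⁅y⁆⇒x≡y
        ; p⊆q⇒∣p∣≤∣q∣; x∈p⇒∣p-x∣<∣p∣; x∈p∧x≢y⇒x∈p-y; p─q⊆p; Empty-unique)
open import Data.List using (List; []; _∷_; length; map; tabulate)
open import Data.List.Properties using (length-map; length-tabulate)
open import Data.List.Membership.Propositional using () renaming (_∈_ to _∈ₗ_)
open import Data.List.Membership.Propositional.Properties using (∈-map⁺; ∈-tabulate⁺)
open import Data.List.Relation.Unary.All as All using (All; []; _∷_)
import Data.List.Relation.Unary.All.Properties as Allₚ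
import Data.List.Relation.Unary.Any as Any
open import Data.List.Relation.Unary.AllPairs using ([]; _∷_)
open import Data.List.Relation.Unary.Unique.Propositional using (Unique)
import Data.List.Relation.Unary.Unique.Propositional.Properties as Uniqueₚ
open import Data.Maybe using (Maybe; just; nothing; _>>=_)
open import Data.Maybe.Properties using (just-injective)
open import Data.Nat using (ℕ; zero; suc; _+_; _*_; _≤_; _<_; z≤n; s≤s)
open import Data.Nat.Properties
  using (≤-reflexive; ≤-trans; ≤-antisym; <⇒≱; n≤1+n; m≤m+n; +-suc; +-comm; +-monoˡ-≤; module ≤-Reasoning)
open import Data.Product using (Σ; ∃; _×_; _,_)
open import Data.Product.Function.NonDependent.Propositional using (_×-↔_)
open import Data.Sum using (_⊎_; inj₁; inj₂)
open import Data.Sum.Function.Propositional using (_⊎-↔_)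
open import Data.Unit using (⊤; tt)
open import Data.Vec as Vec using (_∷_; here; there)
open import Data.Vec.Properties using ([]=⇒lookup; lookup⇒[]=; lookup∘tabulate)
open import Function using (_∘_; _∘′_; case_of_; _↔_; Inverse; mk↔ₛ′)
open import Function.Properties.Inverse using (↔-refl; ↔-trans)
open import Relation.Binary.PropositionalEquality using (_≡_; _≢_; refl; sym; trans; cong; cong₂; subst)
open import Relation.Nullary using (¬_; Dec; yes; no; does; contradiction)
open import Relation.Nullary.Decidable using (_×-dec_; ¬?; dec-true; dec-false)

-- Counting the elements of subsets

∣p∪⁅x⁆∣≤1+∣p∣ : ∀ {n} (p : Subset n) x → ∣ p ∪ ⁅ x ⁆ ∣ ≤ suc ∣ p ∣
∣p∪⁅x⁆∣≤1+∣p∣ (outside ∷ p) zero    = s≤s (≤-reflexive (cong ∣_∣ (∪-identityʳ p)))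
∣p∪⁅x⁆∣≤1+∣p∣ (inside  ∷ p) zero    = s≤s (≤-trans (≤-reflexive (cong ∣_∣ (∪-identityʳ p))) (n≤1+n _))
∣p∪⁅x⁆∣≤1+∣p∣ (outside ∷ p) (suc x) = ∣p∪⁅x⁆∣≤1+∣p∣ p x
∣p∪⁅x⁆∣≤1+∣p∣ (inside  ∷ p) (suc x) = s≤s (∣p∪⁅x⁆∣≤1+∣p∣ p x)

x∉p⇒∣p∪⁅x⁆∣≡1+∣p∣ : ∀ {n} {p : Subset n} {x} → x ∉ p → ∣ p ∪ ⁅ x ⁆ ∣ ≡ suc ∣ p ∣
x∉p⇒∣p∪⁅x⁆∣≡1+∣p∣ {p = outside ∷ p} {x = zero}  _   = cong (suc ∘′ ∣_∣) (∪-identityʳ p)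
x∉p⇒∣p∪⁅x⁆∣≡1+∣p∣ {p = inside  ∷ p} {x = zero}  x∉p = contradiction here x∉p
x∉p⇒∣p∪⁅x⁆∣≡1+∣p∣ {p = outside ∷ p} {x = suc x} x∉p = x∉p⇒∣p∪⁅x⁆∣≡1+∣p∣ (x∉p ∘ there)
x∉p⇒∣p∪⁅x⁆∣≡1+∣p∣ {p = inside  ∷ p} {x = suc x} x∉p = cong suc (x∉p⇒∣p∪⁅x⁆∣≡1+∣p∣ (x∉p ∘ there))

x∈p─q⇒x∉q : ∀ {n} {p q : Subset n} {x} → x ∈ p ─ q → x ∉ q
x∈p─q⇒x∉q {p = _ ∷ p} {outside ∷ q} here        ()
x∈p─q⇒x∉q {p = _ ∷ p} {_ ∷ q}       (there x∈p) (there x∈q) = x∈p─q⇒x∉q x∈p x∈q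

unique⇒length≤∣p∣ : ∀ {n} {p : Subset n} {xs} → Unique xs → All (_∈ p) xs → length xs ≤ ∣ p ∣
unique⇒length≤∣p∣ []         []           = z≤n
unique⇒length≤∣p∣ (x∉xs ∷ u) (x∈p ∷ xs⊆p) =
  ≤-trans (s≤s (unique⇒length≤∣p∣ u (All.zipWith remove (x∉xs , xs⊆p)))) (x∈p⇒∣p-x∣<∣p∣ x∈p)
  where
  remove : ∀ {x y p} → x ≢ y × y ∈ p → y ∈ p - x
  remove (x≢y , y∈p) = x∈p∧x≢y⇒x∈p-y y∈p (x≢y ∘ sym)

∣p∣≤length : ∀ {n} {p : Subset n} xs → (∀ {x} → x ∈ p → x ∈ₗ xs) → ∣ p ∣ ≤ length xs
∣p∣≤length {n} {p} [] p⊆[] =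
  ≤-reflexive (trans (cong ∣_∣ (Empty-unique (λ (_ , x∈p) → case p⊆[] x∈p of λ ()))) (∣⊥∣≡0 n))
∣p∣≤length {p = p} (x ∷ xs) p⊆x∷xs = begin
  ∣ p ∣               ≤⟨ p⊆q⇒∣p∣≤∣q∣ split ⟩
  ∣ (p - x) ∪ ⁅ x ⁆ ∣ ≤⟨ ∣p∪⁅x⁆∣≤1+∣p∣ (p - x) x ⟩
  suc ∣ p - x ∣       ≤⟨ s≤s (∣p∣≤length xs rest) ⟩
  suc (length xs)     ∎
  where
  open ≤-Reasoning
  split : p ⊆ (p - x) ∪ ⁅ x ⁆
  split {y} y∈p with y ≟ x
  ... | yes refl = q⊆p∪q (p - x) _ (x∈⁅x⁆ x)
  ... | no y≢x   = p⊆p∪q _ (x∈p∧x≢y⇒x∈p-y y∈p y≢x)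
  rest : ∀ {y} → y ∈ p - x → y ∈ₗ xs
  rest y∈p-x with p⊆x∷xs (p─q⊆p p ⁅ x ⁆ y∈p-x)
  ... | Any.here refl  = contradiction (x∈⁅x⁆ x) (x∈p─q⇒x∉q y∈p-x)
  ... | Any.there y∈xs = y∈xs

x∈p∪⁅x⁆ : ∀ {n} (p : Subset n) x → x ∈ p ∪ ⁅ x ⁆
x∈p∪⁅x⁆ p x = q⊆p∪q p ⁅ x ⁆ (x∈⁅x⁆ x)

x∈p∪⁅y⁆⁻ : ∀ {n} {p : Subset n} {x y} → x ∈ p ∪ ⁅ y ⁆ → x ∈ p ⊎ x ≡ y
x∈p∪⁅y⁆⁻ {p = p} {y = y} x∈p∪⁅y⁆ with x∈p∪q⁻ p ⁅ y ⁆ x∈p∪⁅y⁆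
... | inj₁ x∈p = inj₁ x∈p
... | inj₂ x∈⁅y⁆ = inj₂ (x∈⁅y⁆⇒x≡y y x∈⁅y⁆)

-- Simple graphs on a type and their components

record SimpleGraph (V : Set) : Set where
  infix 5 _~_
  infix 4 _∈N[_]
  field
    _~_      : V → V → Bool
    ~-sym    : ∀ u v → u ~ v ≡ v ~ u
    ~-irrefl : ∀ v → v ~ v ≡ false

  _∈N[_] : V → V → Set
  y ∈N[ x ] = x ≡ y ⊎ x ~ y ≡ true

infixr 4 _⊕_
_⊕_ : ∀ {A B} → SimpleGraph A → SimpleGraph B → SimpleGraph (A ⊎ B)
_⊕_ {A} {B} G H = record { _~_ = _≈_ ; ~-sym = ≈-sym ; ~-irrefl = ≈-irrefl }
  where
  module G = SimpleGraph G
  module H = SimpleGraph H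
  _≈_ : A ⊎ B → A ⊎ B → Bool
  inj₁ x ≈ inj₁ y = x G.~ y
  inj₂ x ≈ inj₂ y = x H.~ y
  _      ≈ _      = false
  ≈-sym : ∀ u v → u ≈ v ≡ v ≈ u
  ≈-sym (inj₁ x) (inj₁ y) = G.~-sym x y
  ≈-sym (inj₁ x) (inj₂ y) = refl
  ≈-sym (inj₂ x) (inj₁ y) = refl
  ≈-sym (inj₂ x) (inj₂ y) = H.~-sym x y
  ≈-irrefl : ∀ u → u ≈ u ≡ false
  ≈-irrefl (inj₁ x) = G.~-irrefl x
  ≈-irrefl (inj₂ x) = H.~-irrefl x

complete : ∀ m → SimpleGraph (Fin m)
complete m = record
  { _~_      = λ i j → not (does (i ≟ j))
  ; ~-sym    = ≢-sym
  ; ~-irrefl = λ i → cong not (dec-true (i ≟ i) refl)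
  }
  where
  ≢-sym : ∀ i j → not (does (i ≟ j)) ≡ not (does (j ≟ i))
  ≢-sym i j with i ≟ j | j ≟ i
  ... | yes _   | yes _   = refl
  ... | no _    | no _    = refl
  ... | yes i≡j | no j≢i  = contradiction (sym i≡j) j≢i
  ... | no i≢j  | yes j≡i = contradiction (sym j≡i) i≢j

module _ {m : ℕ} where
  private module K = SimpleGraph (complete m)

  complete-∈N : ∀ i j → j K.∈N[ i ]
  complete-∈N i j with i ≟ j
  ... | yes i≡j = inj₁ i≡j
  ... | no i≢j  = inj₂ refl

  complete-~⇒≢ : ∀ {i j} → i K.~ j ≡ true → i ≢ j
  complete-~⇒≢ {i} i~j refl = contradiction (trans (sym i~j) (K.~-irrefl i)) λ ()

record Component {W V : Set} (H : SimpleGraph W) (G : SimpleGraph V) : Set where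
  private
    module H = SimpleGraph H
    module G = SimpleGraph G
  field
    ι        : W → V
    decode   : V → Maybe W
    decode-ι : ∀ x → decode (ι x) ≡ just x
    ~-ι      : ∀ x y → ι x G.~ ι y ≡ x H.~ y
    ~-closed : ∀ x {v} → ι x G.~ v ≡ true → ∃ λ y → v ≡ ι y

  ι-injective : ∀ {x y} → ι x ≡ ι y → x ≡ y
  ι-injective {x} {y} ιx≡ιy = just-injective (trans (sym (decode-ι x)) (trans (cong decode ιx≡ιy) (decode-ι y)))

  ∈N[ι]⁻ : ∀ x {v} → v G.∈N[ ι x ] → ∃ λ y → v ≡ ι y × y H.∈N[ x ]
  ∈N[ι]⁻ x (inj₁ refl) = x , refl , inj₁ refl
  ∈N[ι]⁻ x (inj₂ ιx~v) with ~-closed x ιx~v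
  ... | y , refl = y , refl , inj₂ (trans (sym (~-ι x y)) ιx~v)

  ∈N[ι]⁺ : ∀ {x y} → y H.∈N[ x ] → ι y G.∈N[ ι x ]
  ∈N[ι]⁺ (inj₁ refl) = inj₁ refl
  ∈N[ι]⁺ {x} {y} (inj₂ x~y) = inj₂ (trans (~-ι x y) x~y)

module _ {A B : Set} (G : SimpleGraph A) (H : SimpleGraph B) where
  private module GH = SimpleGraph (G ⊕ H)

  ⊕-inj₁ : Component G (G ⊕ H)
  ⊕-inj₁ = record
    { ι = inj₁ ; decode = decode ; decode-ι = λ _ → refl ; ~-ι = λ _ _ → refl ; ~-closed = closed }
    where
    decode : A ⊎ B → Maybe A
    decode (inj₁ x) = just x
    decode (inj₂ _) = nothing
    closed : ∀ x {v} → inj₁ x GH.~ v ≡ true → ∃ λ y → v ≡ inj₁ y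
    closed x {inj₁ y} _ = y , refl

  ⊕-inj₂ : Component H (G ⊕ H)
  ⊕-inj₂ = record
    { ι = inj₂ ; decode = decode ; decode-ι = λ _ → refl ; ~-ι = λ _ _ → refl ; ~-closed = closed }
    where
    decode : A ⊎ B → Maybe B
    decode (inj₁ _) = nothing
    decode (inj₂ y) = just y
    closed : ∀ y {v} → inj₂ y GH.~ v ≡ true → ∃ λ z → v ≡ inj₂ z
    closed y {inj₂ z} _ = z , refl

infixr 9 _∘ᶜ_
_∘ᶜ_ : ∀ {U V W} {F : SimpleGraph U} {G : SimpleGraph V} {H : SimpleGraph W} →
       Component G F → Component H G → Component H F
_∘ᶜ_ {F = F} C D = record
  { ι        = C.ι ∘ D.ι
  ; decode   = λ v → C.decode v >>= D.decode
  ; decode-ι = λ x → trans (cong (_>>= D.decode) (C.decode-ι (D.ι x))) (D.decode-ι x)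
  ; ~-ι      = λ x y → trans (C.~-ι (D.ι x) (D.ι y)) (D.~-ι x y)
  ; ~-closed = closed
  }
  where
  module C = Component C
  module D = Component D
  module F = SimpleGraph F
  closed : ∀ x {v} → C.ι (D.ι x) F.~ v ≡ true → ∃ λ y → v ≡ C.ι (D.ι y)
  closed x ι~v with C.~-closed (D.ι x) ι~v
  ... | y′ , refl with D.~-closed x (trans (sym (C.~-ι (D.ι x) y′)) ι~v)
  ...   | y , refl = y , refl

module _ {m : ℕ} (i : Fin (suc m)) where
  private module K = SimpleGraph (complete (suc m))

  allBut : List (Fin (suc m))
  allBut = tabulate (punchIn i)

  allBut-length : length allBut ≡ m
  allBut-length = length-tabulate (punchIn i)

  allBut-unique : Unique allBut
  allBut-unique = Uniqueₚ.tabulate⁺ (punchIn-injective i _ _)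

  allBut-adjacent : All (λ j → i K.~ j ≡ true) allBut
  allBut-adjacent = Allₚ.tabulate⁺ (λ j → cong not (dec-false (i ≟ punchIn i j) (punchInᵢ≢i i j ∘ sym)))

  allBut-complete : ∀ {j} → i K.~ j ≡ true → j ∈ₗ allBut
  allBut-complete i~j = subst (_∈ₗ allBut) (punchIn-punchOut i≢j) (∈-tabulate⁺ (punchOut i≢j))
    where i≢j = complete-~⇒≢ i~j

-- The cones H_d

data Cone : ℕ → Set where
  apex : ∀ {d} → Cone d
  copy : ∀ {d} → Bool → Cone d → Cone (suc d)

infix 5 _~ᶜ_
_~ᶜ_ : ∀ {d} → Cone d → Cone d → Bool
apex         ~ᶜ apex         = false
apex         ~ᶜ copy _ _     = true
copy _ _     ~ᶜ apex         = true
copy false x ~ᶜ copy false y = x ~ᶜ y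
copy true  x ~ᶜ copy true  y = x ~ᶜ y
copy false _ ~ᶜ copy true  _ = false
copy true  _ ~ᶜ copy false _ = false

~ᶜ-sym : ∀ {d} (x y : Cone d) → x ~ᶜ y ≡ y ~ᶜ x
~ᶜ-sym apex           apex           = refl
~ᶜ-sym apex           (copy _ _)     = refl
~ᶜ-sym (copy _ _)     apex           = refl
~ᶜ-sym (copy false x) (copy false y) = ~ᶜ-sym x y
~ᶜ-sym (copy false x) (copy true  y) = refl
~ᶜ-sym (copy true  x) (copy false y) = refl
~ᶜ-sym (copy true  x) (copy true  y) = ~ᶜ-sym x y

~ᶜ-irrefl : ∀ {d} (x : Cone d) → x ~ᶜ x ≡ false
~ᶜ-irrefl apex           = refl
~ᶜ-irrefl (copy false x) = ~ᶜ-irrefl x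
~ᶜ-irrefl (copy true  x) = ~ᶜ-irrefl x

cone : ∀ d → SimpleGraph (Cone d)
cone d = record { _~_ = _~ᶜ_ ; ~-sym = ~ᶜ-sym ; ~-irrefl = ~ᶜ-irrefl }

module ConeG {d : ℕ} = SimpleGraph (cone d)

copy-∈N⁻ : ∀ {d b c} {x y : Cone d} → copy c y ConeG.∈N[ copy b x ] → b ≡ c × y ConeG.∈N[ x ]
copy-∈N⁻ (inj₁ refl) = refl , inj₁ refl
copy-∈N⁻ {b = false} {false} (inj₂ x~y) = refl , inj₂ x~y
copy-∈N⁻ {b = true}  {true}  (inj₂ x~y) = refl , inj₂ x~y
copy-∈N⁻ {b = false} {true}  (inj₂ ())
copy-∈N⁻ {b = true}  {false} (inj₂ ())

uncopy : ∀ {d} → Bool → Cone (suc d) → Maybe (Cone d)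
uncopy false (copy false y) = just y
uncopy true  (copy true  y) = just y
uncopy _     _              = nothing

uncopy-copy : ∀ {d} b (x : Cone d) → uncopy b (copy b x) ≡ just x
uncopy-copy false x = refl
uncopy-copy true  x = refl

avoid : ∀ {d} → Maybe (Cone (suc d)) → Bool
avoid (just (copy b _)) = not b
avoid _                 = true

avoid-≢ : ∀ {d} (m : Maybe (Cone (suc d))) x → m ≢ just (copy (avoid m) x)
avoid-≢ nothing               x ()
avoid-≢ (just apex)           x ()
avoid-≢ (just (copy false y)) x ()
avoid-≢ (just (copy true  y)) x ()

copy-injective : ∀ {d b} {x y : Cone d} → copy b x ≡ copy b y → x ≡ y
copy-injective refl = refl

copy-~ᶜ : ∀ {d} b (x y : Cone d) → copy b x ~ᶜ copy b y ≡ x ~ᶜ y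
copy-~ᶜ false x y = refl
copy-~ᶜ true  x y = refl

apex-∈N : ∀ {d} (x : Cone d) → apex ConeG.∈N[ x ]
apex-∈N apex       = inj₁ refl
apex-∈N (copy _ _) = inj₂ refl

someNeighbours : ∀ {d} → Cone d → List (Cone d)
someNeighbours {zero}  apex       = []
someNeighbours {suc d} apex       = copy false apex ∷ map (copy true) (someNeighbours {d} apex)
someNeighbours         (copy b x) = apex ∷ map (copy b) (someNeighbours x)

someNeighbours-length : ∀ {d} (x : Cone d) → length (someNeighbours x) ≡ d
someNeighbours-length {zero}  apex       = refl
someNeighbours-length {suc d} apex       =
  cong suc (trans (length-map (copy true) (someNeighbours {d} apex)) (someNeighbours-length {d} apex))
someNeighbours-length         (copy b x) =
  cong suc (trans (length-map (copy b) (someNeighbours x)) (someNeighbours-length x))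

someNeighbours-unique : ∀ {d} (x : Cone d) → Unique (someNeighbours x)
someNeighbours-unique {zero}  apex       = []
someNeighbours-unique {suc d} apex       =
  Allₚ.map⁺ (All.universal (λ _ ()) _) ∷ Uniqueₚ.map⁺ copy-injective (someNeighbours-unique {d} apex)
someNeighbours-unique         (copy b x) =
  Allₚ.map⁺ (All.universal (λ _ ()) _) ∷ Uniqueₚ.map⁺ copy-injective (someNeighbours-unique x)

someNeighbours-adjacent : ∀ {d} (x : Cone d) → All (λ y → x ~ᶜ y ≡ true) (someNeighbours x)
someNeighbours-adjacent {zero}  apex       = []
someNeighbours-adjacent {suc d} apex       = refl ∷ Allₚ.map⁺ (All.universal (λ _ → refl) _)
someNeighbours-adjacent         (copy b x) =
  refl ∷ Allₚ.map⁺ (All.map (λ {y} x~y → trans (copy-~ᶜ b x y) x~y) (someNeighbours-adjacent x))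

coneSize : ℕ → ℕ
coneSize zero    = 1
coneSize (suc d) = 1 + 2 * coneSize d

Fin↔Cone : ∀ d → Fin (coneSize d) ↔ Cone d
Fin↔Cone zero    = mk↔ₛ′ (λ _ → apex) (λ _ → zero) (λ { apex → refl }) (λ { zero → refl })
Fin↔Cone (suc d) = ↔-trans +↔⊎ (↔-trans (1↔⊤ ⊎-↔ ↔-trans *↔× (2↔Bool ×-↔ Fin↔Cone d)) split)
  where
  split : (⊤ ⊎ Bool × Cone d) ↔ Cone (suc d)
  split = mk↔ₛ′ [apex,copy] unfold fold-unfold unfold-fold
    where
    [apex,copy] : ⊤ ⊎ (Bool × Cone d) → Cone (suc d)
    [apex,copy] (inj₁ _)       = apex
    [apex,copy] (inj₂ (b , x)) = copy b x
    unfold : Cone (suc d) → ⊤ ⊎ (Bool × Cone d)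
    unfold apex       = inj₁ tt
    unfold (copy b x) = inj₂ (b , x)
    fold-unfold : ∀ x → [apex,copy] (unfold x) ≡ x
    fold-unfold apex       = refl
    fold-unfold (copy b x) = refl
    unfold-fold : ∀ u → unfold ([apex,copy] u) ≡ u
    unfold-fold (inj₁ tt)      = refl
    unfold-fold (inj₂ (b , x)) = refl


module Game (G : Graph) where
  open Graph G using (n; adj; irref)

  N[_]ᴳ : Fin n → Subset n
  N[ v ]ᴳ = N[_] G v

  ∈N⁺ : ∀ {w v} → adj w v ≡ true → v ∈ N G w
  ∈N⁺ {w} {v} w~v = lookup⇒[]= v (Vec.tabulate (adj w)) (trans (lookup∘tabulate (adj w) v) w~v)

  ∈N⁻ : ∀ {w v} → v ∈ N G w → adj w v ≡ true
  ∈N⁻ {w} {v} v∈N = trans (sym (lookup∘tabulate (adj w) v)) ([]=⇒lookup v∈N)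

  ∣N[w]∣≡1+deg : ∀ w → ∣ N[ w ]ᴳ ∣ ≡ suc (deg G w)
  ∣N[w]∣≡1+deg w = x∉p⇒∣p∪⁅x⁆∣≡1+∣p∣ (λ w∈N → contradiction (trans (sym (∈N⁻ w∈N)) (irref w)) λ ())

  w∈N[w] : ∀ w → w ∈ N[ w ]ᴳ
  w∈N[w] w = x∈p∪⁅x⁆ (N G w) w

  undominated : ∀ {D} w → (∀ {v} → v ∈ N[ w ]ᴳ → v ∉ D) → ¬ Dominates G D
  undominated w N[w]∩D≡∅ dom with dom w
  ... | u , u∈D , u∈N[w] = N[w]∩D≡∅ u∈N[w] u∈D

  ∅-unclaimed : ¬ StallerClaimed G ∅
  ∅-unclaimed (w , N[w]⊆∅) = ∉⊥ (N[w]⊆∅ (w∈N[w] w))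

  claimed? : ∀ S → Dec (StallerClaimed G S)
  claimed? S = any? (λ v → N[ v ]ᴳ ⊆? S)

  free-vertex : ∀ {D S} → ¬ Dominates G D → ¬ StallerClaimed G S → ∃ λ v → v ∉ D × v ∉ S
  free-vertex {D} {S} ¬dom ¬claimed with any? (λ v → ¬? (v ∈? D) ×-dec ¬? (v ∈? S))
  ... | yes free = free
  ... | no ¬free = contradiction dominates ¬dom
    where
    dominates : Dominates G D
    dominates w with any? (λ u → (u ∈? D) ×-dec (u ∈? N[ w ]ᴳ))
    ... | yes u = u
    ... | no ¬u = contradiction (w , λ {x} → N[w]⊆S {x}) ¬claimed
      where
      N[w]⊆S : N[ w ]ᴳ ⊆ S
      N[w]⊆S {x} x∈N with x ∈? D | x ∈? S
      ... | yes x∈D | _       = contradiction (x , x∈D , x∈N) ¬u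
      ... | no _    | yes x∈S = x∈S
      ... | no x∉D  | no x∉S  = contradiction (x , x∉D , x∉S) ¬free

  -- Dominator's pairing strategy on {a, b}: he answers a by b and b by a, and
  -- plays anywhere otherwise.
  module Pairing (a b : Fin n) (a≢b : a ≢ b) where

    record Respects (D S : Subset n) : Set where
      field
        disjoint : ∀ {v} → v ∈ D → v ∉ S
        not-both : ¬ (a ∈ S × b ∈ S)

    Answered : Subset n → Subset n → Set
    Answered D S = (a ∈ S → b ∈ D) × (b ∈ S → a ∈ D)

    record Threat (j : ℕ) (D S : Subset n) : Set where
      constructor threat
      field
        centre   : Fin n
        avoids   : ∀ {v} → v ∈ N[ centre ]ᴳ → v ∉ D
        not-both : ¬ (a ∈ N[ centre ]ᴳ × b ∈ N[ centre ]ᴳ)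
        size     : ∣ N[ centre ]ᴳ ∣ ≤ ∣ S ∣ + j

    claimed⇒threat : ∀ {j D S} → Respects D S → StallerClaimed G S → Threat j D S
    claimed⇒threat {j} {S = S} r (w , N[w]⊆S) =
      threat w (λ v∈N v∈D → disjoint v∈D (N[w]⊆S v∈N))
               (λ (a∈N , b∈N) → not-both (N[w]⊆S a∈N , N[w]⊆S b∈N))
               (≤-trans (p⊆q⇒∣p∣≤∣q∣ N[w]⊆S) (m≤m+n ∣ S ∣ j))
      where open Respects r

    threat-⊆ : ∀ {j D D′ S} → D ⊆ D′ → Threat j D′ S → Threat j D S
    threat-⊆ D⊆D′ (threat w avoids not-both size) =
      threat w (λ v∈N v∈D → avoids v∈N (D⊆D′ v∈D)) not-both size

    threat-staller : ∀ {j D S u} → Threat j D (S ∪ ⁅ u ⁆) → Threat (suc j) D S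
    threat-staller {j} {S = S} {u} (threat w avoids not-both size) = threat w avoids not-both (begin
      ∣ N[ w ]ᴳ ∣        ≤⟨ size ⟩
      ∣ S ∪ ⁅ u ⁆ ∣ + j  ≤⟨ +-monoˡ-≤ j (∣p∪⁅x⁆∣≤1+∣p∣ S u) ⟩
      suc ∣ S ∣ + j      ≡⟨ +-suc ∣ S ∣ j ⟨
      ∣ S ∣ + suc j      ∎)
      where open ≤-Reasoning

    threat-size-∅ : ∀ {j D} (T : Threat j D ∅) → ∣ N[ Threat.centre T ]ᴳ ∣ ≤ j
    threat-size-∅ {j} T = ≤-trans (Threat.size T) (≤-reflexive (cong (_+ j) (∣⊥∣≡0 n)))

    respects-staller : ∀ {D S u} → Respects D S → Answered D S → u ∉ D → Respects D (S ∪ ⁅ u ⁆)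
    respects-staller {D} {S} {u} r (a↦b , b↦a) u∉D = record { disjoint = disjoint′ ; not-both = not-both′ }
      where
      open Respects r
      disjoint′ : ∀ {v} → v ∈ D → v ∉ S ∪ ⁅ u ⁆
      disjoint′ v∈D v∈S′ with x∈p∪⁅y⁆⁻ v∈S′
      ... | inj₁ v∈S = disjoint v∈D v∈S
      ... | inj₂ refl = u∉D v∈D
      not-both′ : ¬ (a ∈ S ∪ ⁅ u ⁆ × b ∈ S ∪ ⁅ u ⁆)
      not-both′ (a∈S′ , b∈S′) with x∈p∪⁅y⁆⁻ a∈S′ | x∈p∪⁅y⁆⁻ b∈S′
      ... | inj₁ a∈S | inj₁ b∈S = not-both (a∈S , b∈S)
      ... | inj₁ a∈S | inj₂ refl = u∉D (a↦b a∈S)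
      ... | inj₂ refl | inj₁ b∈S = u∉D (b↦a b∈S)
      ... | inj₂ refl | inj₂ b≡a = a≢b (sym b≡a)

    respects-dominator : ∀ {D S v} → Respects D S → v ∉ S → Respects (D ∪ ⁅ v ⁆) S
    respects-dominator {D} {S} {v} r v∉S = record { disjoint = disjoint′ ; not-both = not-both }
      where
      open Respects r
      disjoint′ : ∀ {x} → x ∈ D ∪ ⁅ v ⁆ → x ∉ S
      disjoint′ x∈D′ with x∈p∪⁅y⁆⁻ x∈D′
      ... | inj₁ x∈D = disjoint x∈D
      ... | inj₂ refl = v∉S

    respects-∅ : Respects ∅ ∅
    respects-∅ = record { disjoint = λ _ → ∉⊥ ; not-both = λ (a∈∅ , _) → ∉⊥ a∈∅ }

    answered-∅ : ∀ {D} → Answered D ∅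
    answered-∅ = (λ a∈∅ → contradiction a∈∅ ∉⊥) , (λ b∈∅ → contradiction b∈∅ ∉⊥)

    answered-⊆ : ∀ {D D′ S} → D ⊆ D′ → Answered D S → Answered D′ S
    answered-⊆ D⊆D′ (a↦b , b↦a) = D⊆D′ ∘ a↦b , D⊆D′ ∘ b↦a

    answered-reply : ∀ {D S} → ¬ Dominates G D → ¬ StallerClaimed G S → Answered D S →
                     ∃ λ v → v ∉ D × v ∉ S × Answered (D ∪ ⁅ v ⁆) S
    answered-reply ¬dom ¬claimed ans with free-vertex ¬dom ¬claimed
    ... | v , v∉D , v∉S = v , v∉D , v∉S , answered-⊆ (p⊆p∪q _) ans

    pairing-reply : ∀ {D S} → ¬ Dominates G D → ¬ StallerClaimed G S → Respects D S →
                    ∃ λ v → v ∉ D × v ∉ S × Answered (D ∪ ⁅ v ⁆) S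
    pairing-reply {D} {S} ¬dom ¬claimed r with a ∈? S | b ∈? S
    ... | yes a∈S | yes b∈S = contradiction (a∈S , b∈S) (Respects.not-both r)
    ... | no a∉S  | no b∉S  =
      answered-reply ¬dom ¬claimed ((λ a∈S → contradiction a∈S a∉S) , (λ b∈S → contradiction b∈S b∉S))
    ... | yes a∈S | no b∉S  with b ∈? D
    ...   | yes b∈D = answered-reply ¬dom ¬claimed ((λ _ → b∈D) , (λ b∈S → contradiction b∈S b∉S))
    ...   | no b∉D  = b , b∉D , b∉S , (λ _ → x∈p∪⁅x⁆ D b) , (λ b∈S → contradiction b∈S b∉S)
    pairing-reply {D} {S} ¬dom ¬claimed r | no a∉S | yes b∈S with a ∈? D
    ...   | yes a∈D = answered-reply ¬dom ¬claimed ((λ a∈S → contradiction a∈S a∉S) , (λ _ → a∈D))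
    ...   | no a∉D  = a , a∉D , a∉S , (λ a∈S → contradiction a∈S a∉S) , (λ _ → x∈p∪⁅x⁆ D a)

    staller-S⇒threat : ∀ {j D S} → SWinS G j D S → Respects D S → Answered D S → Threat j D S
    staller-D⇒threat : ∀ {j D S} → SWinD G j D S → Respects D S → Threat j D S
    staller-S⇒threat (wonS claimed) r _ = claimed⇒threat r claimed
    staller-S⇒threat (play u _ _ u∉D _ win) r ans =
      threat-staller (staller-D⇒threat win (respects-staller r ans u∉D))
    staller-D⇒threat (wonD claimed) r = claimed⇒threat r claimed
    staller-D⇒threat (reply ¬dom ¬claimed win) r with pairing-reply ¬dom ¬claimed r
    ... | v , v∉D , v∉S , ans =
      threat-⊆ (p⊆p∪q _) (staller-S⇒threat (win v v∉D v∉S) (respects-dominator r v∉S) ans)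

  record ConeCopy (k : ℕ) (S : Subset n) : Set where
    field
      ι        : Cone k → Fin n
      decode   : Fin n → Maybe (Cone k)
      decode-ι : ∀ x → decode (ι x) ≡ just x
      closed   : ∀ x {v} → v ∈ N[ ι x ]ᴳ → v ∈ S ⊎ ∃ λ y → v ≡ ι y × y ConeG.∈N[ x ]

  record Fresh {k S} (C : ConeCopy k S) (D : Subset n) : Set where
    open ConeCopy C
    field
      disjoint : ∀ {v} → v ∈ D → v ∉ S
      ι∉D      : ∀ x → ι x ∉ D
      ι∉S      : ∀ x → ι x ∉ S

  restrict : ∀ {k S} (C : ConeCopy (suc k) S) → Bool → ConeCopy k (S ∪ ⁅ ConeCopy.ι C apex ⁆)
  restrict {S = S} C b = record
    { ι        = ι ∘ copy b
    ; decode   = λ v → decode v >>= uncopy b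
    ; decode-ι = λ x → trans (cong (_>>= uncopy b) (decode-ι (copy b x))) (uncopy-copy b x)
    ; closed   = closed′
    }
    where
    open ConeCopy C
    closed′ : ∀ x {v} → v ∈ N[ ι (copy b x) ]ᴳ →
              v ∈ S ∪ ⁅ ι apex ⁆ ⊎ ∃ λ y → v ≡ ι (copy b y) × y ConeG.∈N[ x ]
    closed′ x v∈N with closed (copy b x) v∈N
    ... | inj₁ v∈S                  = inj₁ (p⊆p∪q _ v∈S)
    ... | inj₂ (apex , refl , _)    = inj₁ (x∈p∪⁅x⁆ S (ι apex))
    ... | inj₂ (copy c y , refl , near) with copy-∈N⁻ near
    ...   | refl , near′ = inj₂ (y , refl , near′)

  fresh-∅ : ∀ {k} (C : ConeCopy k ∅) → Fresh C ∅
  fresh-∅ C = record { disjoint = λ _ → ∉⊥ ; ι∉D = λ _ → ∉⊥ ; ι∉S = λ _ → ∉⊥ }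

  fresh-⁅v⁆ : ∀ {k v} (C : ConeCopy k ∅) → (∀ x → ConeCopy.ι C x ≢ v) → Fresh C (∅ ∪ ⁅ v ⁆)
  fresh-⁅v⁆ C ι≢v = record { disjoint = λ _ → ∉⊥ ; ι∉D = ι∉D ; ι∉S = λ _ → ∉⊥ }
    where
    ι∉D : ∀ x → ConeCopy.ι C x ∉ ∅ ∪ ⁅ _ ⁆
    ι∉D x ι∈D with x∈p∪⁅y⁆⁻ ι∈D
    ... | inj₁ ι∈∅ = ∉⊥ ι∈∅
    ... | inj₂ ι≡v = ι≢v x ι≡v

  fresh-undominated : ∀ {k S D} {C : ConeCopy k S} → Fresh C D → ¬ Dominates G D
  fresh-undominated {D = D} {C} f = undominated (ι apex) avoids
    where
    open ConeCopy C
    open Fresh f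
    avoids : ∀ {v} → v ∈ N[ ι apex ]ᴳ → v ∉ D
    avoids v∈N v∈D with closed apex v∈N
    ... | inj₁ v∈S            = disjoint v∈D v∈S
    ... | inj₂ (y , refl , _) = ι∉D y v∈D

  fresh-restrict : ∀ {k S D v} (C : ConeCopy (suc k) S) → Fresh C D →
                   v ∉ S ∪ ⁅ ConeCopy.ι C apex ⁆ →
                   Fresh (restrict C (avoid (ConeCopy.decode C v))) (D ∪ ⁅ v ⁆)
  fresh-restrict {S = S} {D} {v} C f v∉S′ = record { disjoint = disjoint′ ; ι∉D = ι∉D′ ; ι∉S = ι∉S′ }
    where
    open ConeCopy C
    open Fresh f
    b = avoid (decode v)
    disjoint′ : ∀ {x} → x ∈ D ∪ ⁅ v ⁆ → x ∉ S ∪ ⁅ ι apex ⁆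
    disjoint′ x∈D′ x∈S′ with x∈p∪⁅y⁆⁻ x∈D′ | x∈p∪⁅y⁆⁻ x∈S′
    ... | inj₂ refl | _         = v∉S′ x∈S′
    ... | inj₁ x∈D  | inj₁ x∈S  = disjoint x∈D x∈S
    ... | inj₁ x∈D  | inj₂ refl = ι∉D apex x∈D
    ι∉D′ : ∀ x → ι (copy b x) ∉ D ∪ ⁅ v ⁆
    ι∉D′ x ι∈D′ with x∈p∪⁅y⁆⁻ ι∈D′
    ... | inj₁ ι∈D = ι∉D (copy b x) ι∈D
    ... | inj₂ ι≡v = avoid-≢ (decode v) x (trans (cong decode (sym ι≡v)) (decode-ι (copy b x)))
    ι∉S′ : ∀ x → ι (copy b x) ∉ S ∪ ⁅ ι apex ⁆
    ι∉S′ x ι∈S′ with x∈p∪⁅y⁆⁻ ι∈S′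
    ... | inj₁ ι∈S = ι∉S (copy b x) ι∈S
    ... | inj₂ ι≡ι with trans (sym (decode-ι (copy b x))) (trans (cong decode ι≡ι) (decode-ι apex))
    ...   | ()

  -- Staller claims the apex of the copy of H_k; Dominator's answer misses one of
  -- its two copies of H_(k-1), where Staller continues.
  cone-strategy : ∀ k {S D} (C : ConeCopy k S) → Fresh C D → SWinS G (suc k) D S
  cone-answer   : ∀ k {S D} (C : ConeCopy k S) → Fresh C D → SWinD G k D (S ∪ ⁅ ConeCopy.ι C apex ⁆)

  cone-strategy k {S} C f with claimed? S
  ... | yes claimed = wonS claimed
  ... | no ¬claimed = play (ι apex) (fresh-undominated f) ¬claimed (ι∉D apex) (ι∉S apex) (cone-answer k C f)
    where
    open ConeCopy C
    open Fresh f

  cone-answer zero {S} C f = wonD (ι apex , λ {v} → N[apex]⊆S′ {v})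
    where
    open ConeCopy C
    N[apex]⊆S′ : N[ ι apex ]ᴳ ⊆ S ∪ ⁅ ι apex ⁆
    N[apex]⊆S′ v∈N with closed apex v∈N
    ... | inj₁ v∈S               = p⊆p∪q _ v∈S
    ... | inj₂ (apex , refl , _) = x∈p∪⁅x⁆ S (ι apex)
  cone-answer (suc k) {S} {D} C f with claimed? (S ∪ ⁅ ConeCopy.ι C apex ⁆)
  ... | yes claimed = wonD claimed
  ... | no ¬claimed = reply (fresh-undominated f) ¬claimed answer
    where
    open ConeCopy C
    answer : ∀ v → v ∉ D → v ∉ S ∪ ⁅ ι apex ⁆ → SWinS G (suc k) (D ∪ ⁅ v ⁆) (S ∪ ⁅ ι apex ⁆)
    answer v _ v∉S′ = cone-strategy k (restrict C (avoid (decode v))) (fresh-restrict C f v∉S′)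

toGraph : ∀ {V n} → SimpleGraph V → Fin n ↔ V → Graph
toGraph {n = n} H enum = record
  { n     = n
  ; adj   = λ i j → to i ~ to j
  ; sym   = λ i j → ~-sym (to i) (to j)
  ; irref = λ i → ~-irrefl (to i)
  }
  where
  open SimpleGraph H
  open Inverse enum

_⊎-enum_ : ∀ {m n} {A B : Set} → Fin m ↔ A → Fin n ↔ B → Fin (m + n) ↔ (A ⊎ B)
e ⊎-enum f = ↔-trans +↔⊎ (e ⊎-↔ f)

module Finite {V : Set} {n : ℕ} (H : SimpleGraph V) (enum : Fin n ↔ V) where
  open SimpleGraph H
  open Inverse enum using (to; from; strictlyInverseˡ; strictlyInverseʳ)

  graph : Graph
  graph = toGraph H enum

  open Game graph

  vertex : V → Fin n
  vertex = from

  label-vertex : ∀ u → to (vertex u) ≡ u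
  label-vertex = strictlyInverseˡ

  every-vertex : ∀ {P : Fin n → Set} → (∀ u → P (vertex u)) → ∀ w → P w
  every-vertex {P} P∘vertex w = subst P (strictlyInverseʳ w) (P∘vertex (to w))

  vertex-injective : ∀ {x y} → vertex x ≡ vertex y → x ≡ y
  vertex-injective {x} {y} eq = trans (sym (label-vertex x)) (trans (cong to eq) (label-vertex y))

  ~⇒∈N : ∀ {x y} → x ~ y ≡ true → vertex y ∈ N graph (vertex x)
  ~⇒∈N {x} {y} x~y = ∈N⁺ (subst (_≡ true) (sym (cong₂ _~_ (label-vertex x) (label-vertex y))) x~y)

  ∈N⇒~ : ∀ {x v} → v ∈ N graph (vertex x) → x ~ to v ≡ true
  ∈N⇒~ {x} {v} v∈N = subst (λ u → u ~ to v ≡ true) (label-vertex x) (∈N⁻ v∈N)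

  ∈N[]⁺ : ∀ {x y} → y ∈N[ x ] → vertex y ∈ N[ vertex x ]ᴳ
  ∈N[]⁺ (inj₁ refl) = w∈N[w] _
  ∈N[]⁺ (inj₂ x~y)  = p⊆p∪q _ (~⇒∈N x~y)

  ∈N[]⁻ : ∀ x {v} → v ∈ N[ vertex x ]ᴳ → ∃ λ y → v ≡ vertex y × y ∈N[ x ]
  ∈N[]⁻ x {v} v∈N[x] with x∈p∪⁅y⁆⁻ v∈N[x]
  ... | inj₂ v≡x = x , v≡x , inj₁ refl
  ... | inj₁ v∈N = to v , sym (strictlyInverseʳ v) , inj₂ (∈N⇒~ v∈N)

  module _ {W} {K : SimpleGraph W} (C : Component K H) where
    open Component C
    private module K = SimpleGraph K

    decode-vertex : ∀ y → decode (to (vertex (ι y))) ≡ just y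
    decode-vertex y = trans (cong decode (label-vertex (ι y))) (decode-ι y)

    component-deg≥ : ∀ x {ys} → Unique ys → All (λ y → x K.~ y ≡ true) ys →
                     length ys ≤ deg graph (vertex (ι x))
    component-deg≥ x {ys} unique adjacent = subst (_≤ _) (length-map (vertex ∘ ι) ys)
      (unique⇒length≤∣p∣ (Uniqueₚ.map⁺ (ι-injective ∘ vertex-injective) unique)
                         (Allₚ.map⁺ (All.map (λ {y} x~y → ~⇒∈N (trans (~-ι x y) x~y)) adjacent)))

    component-deg≤ : ∀ x ys → (∀ {y} → x K.~ y ≡ true → y ∈ₗ ys) →
                     deg graph (vertex (ι x)) ≤ length ys
    component-deg≤ x ys contains =
      ≤-trans (∣p∣≤length (map (vertex ∘ ι) ys) N⊆ys) (≤-reflexive (length-map _ ys))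
      where
      N⊆ys : ∀ {v} → v ∈ N graph (vertex (ι x)) → v ∈ₗ map (vertex ∘ ι) ys
      N⊆ys {v} v∈N with ~-closed x (∈N⇒~ v∈N)
      ... | y , to-v≡ιy = subst (_∈ₗ _) ιy≡v (∈-map⁺ (vertex ∘ ι) (contains x~y))
        where
        ιy≡v : vertex (ι y) ≡ v
        ιy≡v = trans (cong vertex (sym to-v≡ιy)) (strictlyInverseʳ v)
        x~y : x K.~ y ≡ true
        x~y = trans (sym (~-ι x y)) (subst (λ u → ι x ~ u ≡ true) to-v≡ιy (∈N⇒~ v∈N))

  cone-copy : ∀ {k} → Component (cone k) H → ConeCopy k ∅
  cone-copy C = record
    { ι        = vertex ∘ C.ι
    ; decode   = C.decode ∘ to
    ; decode-ι = decode-vertex C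
    ; closed   = closed
    }
    where
    module C = Component C
    closed : ∀ x {v} → v ∈ N[ vertex (C.ι x) ]ᴳ →
             v ∈ ∅ ⊎ ∃ λ y → v ≡ vertex (C.ι y) × y ConeG.∈N[ x ]
    closed x v∈N with ∈N[]⁻ (C.ι x) v∈N
    ... | u , refl , u∈N with C.∈N[ι]⁻ x u∈N
    ...   | y , refl , y∈N = inj₂ (y , refl , y∈N)

  cone-deg≥ : ∀ {d} (C : Component (cone d) H) x → d ≤ deg graph (vertex (Component.ι C x))
  cone-deg≥ C x = ≤-trans (≤-reflexive (sym (someNeighbours-length x)))
                          (component-deg≥ C x (someNeighbours-unique x) (someNeighbours-adjacent x))

  cone-∣N[]∣ : ∀ {d} (C : Component (cone d) H) x → suc d ≤ ∣ N[ vertex (Component.ι C x) ]ᴳ ∣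
  cone-∣N[]∣ C x = ≤-trans (s≤s (cone-deg≥ C x)) (≤-reflexive (sym (∣N[w]∣≡1+deg (vertex (Component.ι C x)))))

  misses-one : ∀ {W} {K : SimpleGraph W} (C D : Component K H) →
               (∀ y → Component.decode C (Component.ι D y) ≡ nothing) →
               ∀ v → (∀ y → vertex (Component.ι C y) ≢ v) ⊎ (∀ y → vertex (Component.ι D y) ≢ v)
  misses-one C D disjoint v with Component.decode C (to v) in decoded
  ... | nothing = inj₁ λ y ιy≡v →
    contradiction (trans (sym (decode-vertex C y)) (trans (cong (C.decode ∘ to) ιy≡v) decoded)) λ ()
    where module C = Component C
  ... | just _  = inj₂ λ y ιy≡v →
    contradiction (trans (sym decoded) (trans (cong (C.decode ∘ to) (sym ιy≡v))
                                       (trans (cong C.decode (label-vertex _)) (disjoint y)))) λ ()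
    where module C = Component C

module Witness (k s t : ℕ) where
  Vertex : Set
  Vertex = Fin (2 + k) ⊎ Cone s ⊎ Cone t ⊎ Cone t

  H : SimpleGraph Vertex
  H = complete (2 + k) ⊕ cone s ⊕ cone t ⊕ cone t

  enum : Fin (2 + k + (coneSize s + (coneSize t + coneSize t))) ↔ Vertex
  enum = ↔-refl ⊎-enum (Fin↔Cone s ⊎-enum (Fin↔Cone t ⊎-enum Fin↔Cone t))

  open Finite H enum

  G : Graph
  G = graph

  open Game G

  K : Component (complete (2 + k)) H
  K = ⊕-inj₁ _ _

  X : Component (cone s) H
  X = ⊕-inj₂ _ _ ∘ᶜ ⊕-inj₁ _ _

  Y₁ Y₂ : Component (cone t) H
  Y₁ = ⊕-inj₂ _ _ ∘ᶜ ⊕-inj₂ _ _ ∘ᶜ ⊕-inj₁ _ _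
  Y₂ = ⊕-inj₂ _ _ ∘ᶜ ⊕-inj₂ _ _ ∘ᶜ ⊕-inj₂ _ _

  a b h : Fin (Graph.n G)
  a = vertex (inj₁ zero)
  b = vertex (inj₁ (suc zero))
  h = vertex (inj₂ (inj₁ apex))

  a≢b : a ≢ b
  a≢b a≡b with vertex-injective {inj₁ zero} {inj₁ (suc zero)} a≡b
  ... | ()

  K-deg : ∀ i → deg G (vertex (inj₁ i)) ≡ suc k
  K-deg i = ≤-antisym
    (≤-trans (component-deg≤ K i (allBut i) (allBut-complete i)) (≤-reflexive (allBut-length i)))
    (≤-trans (≤-reflexive (sym (allBut-length i))) (component-deg≥ K i (allBut-unique i) (allBut-adjacent i)))

  min-degree : suc k ≤ s → s ≤ t → MinDegree G (suc k)
  min-degree k<s s≤t = every-vertex deg≥ , a , K-deg zero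
    where
    deg≥ : ∀ u → suc k ≤ deg G (vertex u)
    deg≥ (inj₁ i)               = ≤-reflexive (sym (K-deg i))
    deg≥ (inj₂ (inj₁ x))        = ≤-trans k<s (cone-deg≥ X x)
    deg≥ (inj₂ (inj₂ (inj₁ y))) = ≤-trans (≤-trans k<s s≤t) (cone-deg≥ Y₁ y)
    deg≥ (inj₂ (inj₂ (inj₂ y))) = ≤-trans (≤-trans k<s s≤t) (cone-deg≥ Y₂ y)

  staller-wins-S-game : SWinS G (suc s) ∅ ∅
  staller-wins-S-game = cone-strategy s (cone-copy X) (fresh-∅ _)

  staller-wins-D-game : SWinD G (suc t) ∅ ∅
  staller-wins-D-game = reply (undominated a (λ {v} _ → ∉⊥ {x = v})) ∅-unclaimed answer
    where
    answer : ∀ v → v ∉ ∅ → v ∉ ∅ → SWinS G (suc t) (∅ ∪ ⁅ v ⁆) ∅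
    answer v _ _ with misses-one Y₁ Y₂ (λ _ → refl) v
    ... | inj₁ misses-Y₁ = cone-strategy t (cone-copy Y₁) (fresh-⁅v⁆ (cone-copy Y₁) misses-Y₁)
    ... | inj₂ misses-Y₂ = cone-strategy t (cone-copy Y₂) (fresh-⁅v⁆ (cone-copy Y₂) misses-Y₂)

  open Pairing a b a≢b

  ab∈N[K] : ∀ i → a ∈ N[ vertex (inj₁ i) ]ᴳ × b ∈ N[ vertex (inj₁ i) ]ᴳ
  ab∈N[K] i = ∈N[]⁺ (Component.∈N[ι]⁺ K (complete-∈N i zero))
            , ∈N[]⁺ (Component.∈N[ι]⁺ K (complete-∈N i (suc zero)))

  h∈N[X] : ∀ x → h ∈ N[ vertex (inj₂ (inj₁ x)) ]ᴳ
  h∈N[X] x = ∈N[]⁺ (Component.∈N[ι]⁺ X (apex-∈N x))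

  ∣N[]∣-S : s ≤ t → ∀ w → ¬ (a ∈ N[ w ]ᴳ × b ∈ N[ w ]ᴳ) → suc s ≤ ∣ N[ w ]ᴳ ∣
  ∣N[]∣-S s≤t = every-vertex λ where
    (inj₁ i)               not-both → contradiction (ab∈N[K] i) not-both
    (inj₂ (inj₁ x))        _        → cone-∣N[]∣ X x
    (inj₂ (inj₂ (inj₁ y))) _        → ≤-trans (s≤s s≤t) (cone-∣N[]∣ Y₁ y)
    (inj₂ (inj₂ (inj₂ y))) _        → ≤-trans (s≤s s≤t) (cone-∣N[]∣ Y₂ y)

  ∣N[]∣-D : ∀ w → h ∉ N[ w ]ᴳ → ¬ (a ∈ N[ w ]ᴳ × b ∈ N[ w ]ᴳ) → suc t ≤ ∣ N[ w ]ᴳ ∣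
  ∣N[]∣-D = every-vertex λ where
    (inj₁ i)               _   not-both → contradiction (ab∈N[K] i) not-both
    (inj₂ (inj₁ x))        h∉N _        → contradiction (h∈N[X] x) h∉N
    (inj₂ (inj₂ (inj₁ y))) _   _        → cone-∣N[]∣ Y₁ y
    (inj₂ (inj₂ (inj₂ y))) _   _        → cone-∣N[]∣ Y₂ y

  S-game-lower : s ≤ t → ∀ j → j < suc s → ¬ SWinS G j ∅ ∅
  S-game-lower s≤t j j<1+s win = <⇒≱ j<1+s (≤-trans (∣N[]∣-S s≤t centre not-both) (threat-size-∅ T))
    where
    T = staller-S⇒threat win respects-∅ answered-∅
    open Threat T

  D-game-lower : ∀ j → j < suc t → ¬ SWinD G j ∅ ∅
  D-game-lower j j<1+t (wonD claimed) = ∅-unclaimed claimed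
  D-game-lower j j<1+t (reply _ _ win) =
    <⇒≱ j<1+t (≤-trans (∣N[]∣-D centre (λ h∈N → avoids h∈N (x∈p∪⁅x⁆ ∅ h)) not-both) (threat-size-∅ T))
    where
    T = staller-S⇒threat (win h ∉⊥ ∉⊥) (respects-dominator {v = h} respects-∅ ∉⊥) answered-∅
    open Threat T

theorem3p2 : (r s t : ℕ) → 2 ≤ r → r ≤ s → s ≤ t →
    Σ Graph λ G → (∃ λ d → MinDegree G d × d + 1 ≡ r) × γ'SMB≡ G s × γSMB≡ G t
theorem3p2 .(2 + k) .(suc s) .(suc t) (s≤s (s≤s z≤n)) (s≤s {suc k} {s} k<s) (s≤s {_} {t} s≤t) =
  G , (suc k , min-degree k<s s≤t , +-comm (suc k) 1)
    , (staller-wins-S-game , S-game-lower s≤t)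
    , (staller-wins-D-game , D-game-lower)
  where open Witness k s t
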